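{- Let $y,z$ be indeterminates and let $(A_{n,k})$ be defined by $A_{0,0}=1$, $A_{0,k}=0$ for $k>0$, and for $n\ge1$, $A_{n,k}=A_{n-1,k-1}+yA_{n-1,k}+zA_{n-1,k+1}$ for all $k\ge 0$ (with $A_{n-1,-1}=0$). Use the convention $A_{n,k}=0$ whenever $n<0$, $k<0$ or $k>n$. Then for any integers $m,n,r$ with $m\ge n\ge 0$, $$\sum_{k=0}^{m} z^k\,\mathrm{per}\begin{pmatrix} A_{n,k} & A_{n+r,k+1}\\ A_{m,k} & A_{m+r,k+1}\end{pmatrix}=A_{m+n+r,1}+H_{n,m}(r),$$ where $H_{n,m}(r)=\sum_{i=0}^{r-1}A_{n+i,0}A_{m+r-i-1,0}$ if $r\ge 1$, $H_{n,m}(0)=0$, and $H_{n,m}(r)=-\sum_{i=1}^{|r|}A_{n-i,0}A_{m-|r|+i-1,0}$ if $r\le -1$.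
   Context: $\mathrm{per}$ denotes the permanent: $\mathrm{per}\begin{pmatrix}a&b\\c&d\end{pmatrix}=ad+bc$. The array $(A_{n,k})$ is the recursive matrix with $\sigma=(y,y,y,\ldots)$, $\tau=(z,z,z,\ldots)$. -}

module Defs where

open import Level using (Level)
open import Algebra.Bundles using (CommutativeRing)
open import Data.Nat using (ℕ; zero; suc)
open import Data.Integer as ℤ using (ℤ; +_; -[1+_])

-- Everything is stated over an arbitrary commutative ring R with arbitrary
-- elements y z : R.  (An identity holds in ℤ[y,z] iff it holds for every
-- commutative ring and every choice of y, z.)
module Recursive {c ℓ : Level} (R : CommutativeRing c ℓ) (y z : CommutativeRing.Carrier R) where
  open CommutativeRing R

  ∑ : ℕ → (ℕ → Carrier) → Carrier
  ∑ zero    f = 0#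
  ∑ (suc n) f = ∑ n f + f n

  _^_ : Carrier → ℕ → Carrier
  x ^ zero  = 1#
  x ^ suc k = x * (x ^ k)

  A : ℕ → ℕ → Carrier
  A zero    zero          = 1#
  A zero    (suc k)       = 0#
  A (suc n) zero          = y * A n 0 + z * A n 1
  A (suc n) (suc k)       = A n k + y * A n (suc k) + z * A n (suc (suc k))

  -- extension to integer indices: A_{n,k} = 0 if n < 0 or k < 0
  -- (A n k = 0 for k > n follows from the recursion)
  Aℤ : ℤ → ℤ → Carrier
  Aℤ (+ n)    (+ k)    = A n k
  Aℤ (+ n)    -[1+ k ] = 0#
  Aℤ -[1+ n ] _        = 0#

  per : Carrier → Carrier → Carrier → Carrier → Carrier
  per a b c d = a * d + b * c

  H : ℕ → ℕ → ℤ → Carrier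
  H n m (+ zero)    = 0#
  H n m (+ suc r')  =
    ∑ (suc r') (λ i → Aℤ (+ n ℤ.+ + i) (+ 0) * Aℤ (+ m ℤ.+ + suc r' ℤ.- + i ℤ.- + 1) (+ 0))
  H n m -[1+ r' ]   =
    - ∑ (suc r') (λ j → let i = suc j in
                         Aℤ (+ n ℤ.- + i) (+ 0) * Aℤ (+ m ℤ.- + suc r' ℤ.+ + i ℤ.- + 1) (+ 0))

module Submission where

-- Write S a b = Σ_k z^k A_{a,k} A_{b,k+1}, so that the left side is S n (m + r) + S m (n + r).
-- Expanding both sides by the recursion gives S a (b + 1) = S (a + 1) b + A_{a,0} A_{b,0}:
-- moving one unit from the second index to the first costs one product of first-column entries.
-- Applied to both terms, it shows that S a b + S b a depends only on a + b, hence equals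
-- S (a + b) 0 + S 0 (a + b) = A_{a+b,1}. Moving r units gives
-- S a (b + r) = S (a + r) b + Σ_{i+j=r-1} A_{a+i,0} A_{b+j,0}, a convolution which is ±H. For r = -R ≤ -1 one shifts S n (m - R) back to
-- S (n - R) m when R ≤ n; when R > n the term S m (n - R) vanishes, one shifts from S 0 instead,
-- and the convolution loses its terms with negative row index.

open import Defs
open import Level using (Level)
open import Algebra.Bundles using (CommutativeRing)
open import Data.Nat as ℕ using (ℕ; zero; suc; _≤_; _<_; _≤′_; ≤′-reflexive; ≤′-step; s≤s; _≤?_)
import Data.Nat.Properties as ℕ
open import Data.Integer as ℤ using (ℤ; +_; -[1+_])
import Data.Integer.Properties as ℤ
open import Data.Integer.Tactic.RingSolver using (solve-∀)
open import Data.Product using (_,_)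
open import Relation.Nullary using (yes; no)
open import Relation.Binary.PropositionalEquality as ≡ using (_≡_)

module Identities {c ℓ : Level} (R : CommutativeRing c ℓ) (y z : CommutativeRing.Carrier R) where
  open CommutativeRing R
  open Recursive R y z
  open import Relation.Binary.Reasoning.Setoid setoid
  open import Algebra.Properties.Group +-group using (∙-cancelʳ; x≈z//y)
  open import Algebra.Properties.CommutativeSemigroup +-commutativeSemigroup
    using (interchange; xy∙z≈x∙zy; xy∙z≈xz∙y; xy∙z≈zx∙y)
  import Algebra.Solver.Ring.NaturalCoefficients.Default commutativeSemiring as R-Solver

  ∑-cong : ∀ n {f g : ℕ → Carrier} → (∀ i → f i ≈ g i) → ∑ n f ≈ ∑ n g
  ∑-cong zero    f≈g = refl
  ∑-cong (suc n) f≈g = +-cong (∑-cong n f≈g) (f≈g n)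

  ∑-zero : ∀ n {f : ℕ → Carrier} → (∀ i → f i ≈ 0#) → ∑ n f ≈ 0#
  ∑-zero zero    f≈0 = refl
  ∑-zero (suc n) f≈0 = trans (+-cong (∑-zero n f≈0) (f≈0 n)) (+-identityʳ 0#)

  ∑-distrib-+ : ∀ n (f g : ℕ → Carrier) → ∑ n (λ i → f i + g i) ≈ ∑ n f + ∑ n g
  ∑-distrib-+ zero    f g = sym (+-identityʳ 0#)
  ∑-distrib-+ (suc n) f g = trans (+-congʳ (∑-distrib-+ n f g)) (interchange _ _ _ _)

  ∑-sucˡ : ∀ n (f : ℕ → Carrier) → ∑ (suc n) f ≈ f 0 + ∑ n (λ i → f (suc i))
  ∑-sucˡ zero    f = +-comm 0# (f 0)
  ∑-sucˡ (suc n) f = trans (+-congʳ (∑-sucˡ n f)) (+-assoc _ _ _)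

  ∑-extend : ∀ {n L} (f : ℕ → Carrier) → (∀ i → n ≤ i → f i ≈ 0#) → n ≤ L → ∑ L f ≈ ∑ n f
  ∑-extend {n} f tail n≤L = go (ℕ.≤⇒≤′ n≤L)
    where
    go : ∀ {L} → n ≤′ L → ∑ L f ≈ ∑ n f
    go (≤′-reflexive ≡.refl) = refl
    go (≤′-step n≤′L)        = trans (+-cong (go n≤′L) (tail _ (ℕ.≤′⇒≤ n≤′L))) (+-identityʳ _)

  -- Summation by parts, arranged so that no subtraction occurs.
  ∑-telescope : ∀ {f f′ g h : ℕ → Carrier} →
                (∀ k → f k + g (suc k) + h k ≈ f′ k + g k + h (suc k)) →
                ∀ n → ∑ n f + g n + h 0 ≈ ∑ n f′ + g 0 + h n
  ∑-telescope step zero = refl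
  ∑-telescope {f} {f′} {g} {h} step (suc n) = ∙-cancelʳ (g n + h n) _ _ (begin
      (∑ n f + f n + g (suc n) + h 0) + (g n + h n)    ≈⟨ regroupˡ _ _ _ _ _ _ ⟩
      (∑ n f + g n + h 0) + (f n + g (suc n) + h n)    ≈⟨ +-cong (∑-telescope step n) (step n) ⟩
      (∑ n f′ + g 0 + h n) + (f′ n + g n + h (suc n))  ≈⟨ regroupʳ _ _ _ _ _ _ ⟩
      (∑ n f′ + f′ n + g 0 + h (suc n)) + (g n + h n)  ∎)
    where
    open R-Solver
    regroupˡ : ∀ s a b c d e → (s + a + b + c) + (d + e) ≈ (s + d + c) + (a + b + e)
    regroupˡ = solve 6 (λ s a b c d e →
      (s :+ a :+ b :+ c) :+ (d :+ e) := (s :+ d :+ c) :+ (a :+ b :+ e)) refl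
    regroupʳ : ∀ s a b c d e → (s + a + b) + (c + d + e) ≈ (s + c + a + e) + (d + b)
    regroupʳ = solve 6 (λ s a b c d e →
      (s :+ a :+ b) :+ (c :+ d :+ e) := (s :+ c :+ a :+ e) :+ (d :+ b)) refl

  0+y*0+z*0≈0 : 0# + y * 0# + z * 0# ≈ 0#
  0+y*0+z*0≈0 = trans (+-cong (+-congˡ (zeroʳ y)) (zeroʳ z)) (trans (+-identityʳ _) (+-identityʳ 0#))

  x*[y*0]≈0 : ∀ x y → x * (y * 0#) ≈ 0#
  x*[y*0]≈0 x y = trans (*-congˡ (zeroʳ y)) (zeroʳ x)

  A-above-diagonal : ∀ {a k} → a < k → A a k ≈ 0#
  A-above-diagonal {zero}  {suc k} _           = refl
  A-above-diagonal {suc a} {suc k} (s≤s a<k) = trans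
    (+-cong (+-cong (A-above-diagonal a<k) (*-congˡ (A-above-diagonal (ℕ.m<n⇒m<1+n a<k))))
            (*-congˡ (A-above-diagonal (ℕ.m<n⇒m<1+n (ℕ.m<n⇒m<1+n a<k)))))
    0+y*0+z*0≈0

  *-A-above-diagonal : ∀ {a k} w x → a < k → w * (A a k * x) ≈ 0#
  *-A-above-diagonal w x a<k =
    trans (*-congˡ (trans (*-congʳ (A-above-diagonal a<k)) (zeroˡ x))) (zeroʳ w)

  Aℤ-recursion : ∀ b k → Aℤ (+ 1 ℤ.+ b) (+ suc k)
                         ≈ Aℤ b (+ k) + y * Aℤ b (+ suc k) + z * Aℤ b (+ suc (suc k))
  Aℤ-recursion (+ b)          k = refl
  Aℤ-recursion -[1+ zero ]    k = sym 0+y*0+z*0≈0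
  Aℤ-recursion -[1+ suc d ]   k = sym 0+y*0+z*0≈0

  A₀ : ℤ → Carrier
  A₀ x = Aℤ x (+ 0)

  S-term : ℕ → ℤ → ℕ → Carrier
  S-term a b k = z ^ k * (A a k * Aℤ b (+ suc k))

  S : ℕ → ℤ → Carrier
  S a b = ∑ (suc a) (S-term a b)

  S-extend : ∀ {a L} b → suc a ≤ L → ∑ L (S-term a b) ≈ S a b
  S-extend b = ∑-extend _ (λ k a<k → *-A-above-diagonal _ _ a<k)

  S-zeroʳ : ∀ a → S a (+ 0) ≈ 0#
  S-zeroʳ a = ∑-zero (suc a) (λ k → x*[y*0]≈0 _ _)

  S-negative : ∀ a d → S a -[1+ d ] ≈ 0#
  S-negative a d = ∑-zero (suc a) (λ k → x*[y*0]≈0 _ _)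

  S-zeroˡ : ∀ w → S 0 w ≈ Aℤ w (+ 1)
  S-zeroˡ w = trans (+-identityˡ _) (trans (*-identityˡ _) (*-identityˡ _))

  -- Expanding A_{a+1,k} and A_{b+1,k+1} by the recursion, the y-terms agree and the
  -- remaining terms telescope; only k = 0 survives.
  S-step : ∀ a b → S a (+ 1 ℤ.+ b) ≈ S (suc a) b + A a 0 * A₀ b
  S-step a b = begin
      S a (+ 1 ℤ.+ b)                         ≈⟨ sym (S-extend (+ 1 ℤ.+ b) (ℕ.n≤1+n _)) ⟩
      ∑ L (S-term a (+ 1 ℤ.+ b))
        ≈⟨ sym (trans (+-identityʳ _) (trans (+-congˡ P-top) (+-identityʳ _))) ⟩
      ∑ L (S-term a (+ 1 ℤ.+ b)) + P L + Q 0  ≈⟨ ∑-telescope recursion-at L ⟩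
      S (suc a) b + P 0 + Q L                 ≈⟨ trans (+-congˡ Q-top) (+-identityʳ _) ⟩
      S (suc a) b + P 0                       ≈⟨ +-congˡ (*-identityˡ _) ⟩
      S (suc a) b + A a 0 * A₀ b              ∎
    where
    L = suc (suc a)

    P : ℕ → Carrier
    P k = z ^ k * (A a k * Aℤ b (+ k))

    Q : ℕ → Carrier
    Q zero    = 0#
    Q (suc k) = z ^ suc k * (A a k * Aℤ b (+ suc (suc k)))

    P-top : P L ≈ 0#
    P-top = *-A-above-diagonal _ _ (ℕ.m<n⇒m<1+n (ℕ.n<1+n a))

    Q-top : Q L ≈ 0#
    Q-top = *-A-above-diagonal _ _ (ℕ.n<1+n a)

    open R-Solver

    recursion-at : ∀ k → S-term a (+ 1 ℤ.+ b) k + P (suc k) + Q k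
                         ≈ S-term (suc a) b k + P k + Q (suc k)
    recursion-at zero = trans (+-congʳ (+-congʳ (*-congˡ (*-congˡ (Aℤ-recursion b 0)))))
      (solve 7 (λ a₀ a₁ b₀ b₁ b₂ y z →
          con 1 :* (a₀ :* (b₀ :+ y :* b₁ :+ z :* b₂)) :+ (z :* con 1) :* (a₁ :* b₁) :+ con 0
        := con 1 :* ((y :* a₀ :+ z :* a₁) :* b₁) :+ con 1 :* (a₀ :* b₀) :+ (z :* con 1) :* (a₀ :* b₂))
        refl (A a 0) (A a 1) (Aℤ b (+ 0)) (Aℤ b (+ 1)) (Aℤ b (+ 2)) y z)
    recursion-at (suc j) = trans (+-congʳ (+-congʳ (*-congˡ (*-congˡ (Aℤ-recursion b (suc j))))))
      (solve 9 (λ w y z aⱼ aₖ aₖ₊₁ bₖ bₖ₊₁ bₖ₊₂ →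
          w :* (aₖ :* (bₖ :+ y :* bₖ₊₁ :+ z :* bₖ₊₂)) :+ (z :* w) :* (aₖ₊₁ :* bₖ₊₁) :+ w :* (aⱼ :* bₖ₊₁)
        := w :* ((aⱼ :+ y :* aₖ :+ z :* aₖ₊₁) :* bₖ₊₁) :+ w :* (aₖ :* bₖ) :+ (z :* w) :* (aₖ :* bₖ₊₂))
        refl (z ^ suc j) y z (A a j) (A a (suc j)) (A a (suc (suc j)))
             (Aℤ b (+ suc j)) (Aℤ b (+ suc (suc j))) (Aℤ b (+ suc (suc (suc j)))))

  S-diagonal : ∀ a b → S a (+ b) + S b (+ a) ≈ A (a ℕ.+ b) 1
  S-diagonal a zero = begin
    S a (+ 0) + S 0 (+ a)  ≈⟨ +-cong (S-zeroʳ a) (S-zeroˡ (+ a)) ⟩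
    0# + A a 1             ≈⟨ +-identityˡ _ ⟩
    A a 1                  ≡⟨ ≡.cong (λ t → A t 1) (≡.sym (ℕ.+-identityʳ a)) ⟩
    A (a ℕ.+ 0) 1          ∎
  S-diagonal a (suc b) = begin
    S a (+ suc b) + S (suc b) (+ a)                      ≈⟨ +-congʳ (S-step a (+ b)) ⟩
    S (suc a) (+ b) + A a 0 * A b 0 + S (suc b) (+ a)    ≈⟨ +-assoc _ _ _ ⟩
    S (suc a) (+ b) + (A a 0 * A b 0 + S (suc b) (+ a))
      ≈⟨ +-congˡ (trans (+-comm _ _) (+-congˡ (*-comm _ _))) ⟩
    S (suc a) (+ b) + (S (suc b) (+ a) + A b 0 * A a 0)  ≈⟨ +-congˡ (sym (S-step b (+ a))) ⟩
    S (suc a) (+ b) + S b (+ suc a)                      ≈⟨ S-diagonal (suc a) b ⟩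
    A (suc a ℕ.+ b) 1                                    ≡⟨ ≡.cong (λ t → A t 1) (≡.sym (ℕ.+-suc a b)) ⟩
    A (a ℕ.+ suc b) 1                                    ∎

  -- Conv x y r = Σ_{i+j=r-1} A_{x+i,0} A_{y+j,0}, written in the indexing of H.
  Conv : ℤ → ℤ → ℕ → Carrier
  Conv x y r = ∑ r (λ i → A₀ (x ℤ.+ + i) * A₀ (y ℤ.+ + r ℤ.- + i ℤ.- + 1))

  Conv-sucʳ : ∀ x y r → Conv x y (suc r) ≈ Conv x (+ 1 ℤ.+ y) r + A₀ (x ℤ.+ + r) * A₀ y
  Conv-sucʳ x y r = +-cong
    (∑-cong r (λ i → reflexive (≡.cong (λ t → A₀ (x ℤ.+ + i) * A₀ t) (shift y (+ r) (+ i)))))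
    (reflexive (≡.cong (λ t → A₀ (x ℤ.+ + r) * A₀ t) (last y (+ r))))
    where
    shift : ∀ y r i → y ℤ.+ (+ 1 ℤ.+ r) ℤ.- i ℤ.- + 1 ≡ (+ 1 ℤ.+ y) ℤ.+ r ℤ.- i ℤ.- + 1
    shift = solve-∀
    last : ∀ y r → y ℤ.+ (+ 1 ℤ.+ r) ℤ.- r ℤ.- + 1 ≡ y
    last = solve-∀

  Conv-sucˡ : ∀ x y r → Conv x y (suc r) ≈ A₀ x * A₀ (y ℤ.+ + r) + Conv (+ 1 ℤ.+ x) y r
  Conv-sucˡ x y r = trans (∑-sucˡ r _) (+-cong
    (reflexive (≡.cong₂ (λ u v → A₀ u * A₀ v) (ℤ.+-identityʳ x) (first y (+ r))))
    (∑-cong r (λ i → reflexive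
      (≡.cong₂ (λ u v → A₀ u * A₀ v) (shiftˡ x (+ i)) (shiftʳ y (+ r) (+ i))))))
    where
    first : ∀ y r → y ℤ.+ (+ 1 ℤ.+ r) ℤ.- + 0 ℤ.- + 1 ≡ y ℤ.+ r
    first = solve-∀
    shiftˡ : ∀ x i → x ℤ.+ (+ 1 ℤ.+ i) ≡ (+ 1 ℤ.+ x) ℤ.+ i
    shiftˡ = solve-∀
    shiftʳ : ∀ y r i → y ℤ.+ (+ 1 ℤ.+ r) ℤ.- (+ 1 ℤ.+ i) ℤ.- + 1 ≡ y ℤ.+ r ℤ.- i ℤ.- + 1
    shiftʳ = solve-∀

  Conv-comm : ∀ x y r → Conv x y r ≈ Conv y x r
  Conv-comm x y zero    = refl
  Conv-comm x y (suc r) = begin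
    Conv x y (suc r)                                       ≈⟨ Conv-sucʳ x y r ⟩
    Conv x (+ 1 ℤ.+ y) r + A₀ (x ℤ.+ + r) * A₀ y           ≈⟨ +-cong (Conv-comm x (+ 1 ℤ.+ y) r) (*-comm _ _) ⟩
    Conv (+ 1 ℤ.+ y) x r + A₀ y * A₀ (x ℤ.+ + r)           ≈⟨ +-comm _ _ ⟩
    A₀ y * A₀ (x ℤ.+ + r) + Conv (+ 1 ℤ.+ y) x r           ≈⟨ sym (Conv-sucˡ y x r) ⟩
    Conv y x (suc r)                                       ∎

  -- Terms whose second factor has negative row index vanish.
  Conv-negative : ∀ x d r → Conv x (ℤ.- + d) (d ℕ.+ r) ≈ Conv x (+ 0) r
  Conv-negative x zero    r = refl
  Conv-negative x (suc d) r = begin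
    Conv x -[1+ d ] (suc d ℕ.+ r)                  ≈⟨ Conv-sucʳ x -[1+ d ] (d ℕ.+ r) ⟩
    Conv x (+ 1 ℤ.+ -[1+ d ]) (d ℕ.+ r) + _ * 0#   ≈⟨ trans (+-congˡ (zeroʳ _)) (+-identityʳ _) ⟩
    Conv x (+ 1 ℤ.+ -[1+ d ]) (d ℕ.+ r)            ≡⟨ ≡.cong (λ t → Conv x t (d ℕ.+ r)) (1-[1+d] (+ d)) ⟩
    Conv x (ℤ.- + d) (d ℕ.+ r)                     ≈⟨ Conv-negative x d r ⟩
    Conv x (+ 0) r                                 ∎
    where
    1-[1+d] : ∀ d → + 1 ℤ.+ ℤ.- (+ 1 ℤ.+ d) ≡ ℤ.- d
    1-[1+d] = solve-∀

  S-shift : ∀ r a b → S a (+ r ℤ.+ b) ≈ S (r ℕ.+ a) b + Conv (+ a) b r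
  S-shift zero    a b = trans (reflexive (≡.cong (S a) (ℤ.+-identityˡ b))) (sym (+-identityʳ _))
  S-shift (suc r) a b = begin
    S a (+ suc r ℤ.+ b)                                          ≡⟨ ≡.cong (S a) (regroup (+ r) b) ⟩
    S a (+ r ℤ.+ (+ 1 ℤ.+ b))                                    ≈⟨ S-shift r a (+ 1 ℤ.+ b) ⟩
    S (r ℕ.+ a) (+ 1 ℤ.+ b) + Conv (+ a) (+ 1 ℤ.+ b) r           ≈⟨ +-congʳ (S-step (r ℕ.+ a) b) ⟩
    S (suc r ℕ.+ a) b + A (r ℕ.+ a) 0 * A₀ b + Conv (+ a) (+ 1 ℤ.+ b) r
      ≈⟨ xy∙z≈x∙zy _ _ _ ⟩
    S (suc r ℕ.+ a) b + (Conv (+ a) (+ 1 ℤ.+ b) r + A (r ℕ.+ a) 0 * A₀ b)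
      ≡⟨ ≡.cong (λ t → S (suc r ℕ.+ a) b + (Conv (+ a) (+ 1 ℤ.+ b) r + A t 0 * A₀ b))
                (ℕ.+-comm r a) ⟩
    S (suc r ℕ.+ a) b + (Conv (+ a) (+ 1 ℤ.+ b) r + A (a ℕ.+ r) 0 * A₀ b)
      ≈⟨ +-congˡ (sym (Conv-sucʳ (+ a) b r)) ⟩
    S (suc r ℕ.+ a) b + Conv (+ a) b (suc r)                     ∎
    where
    regroup : ∀ r b → (+ 1 ℤ.+ r) ℤ.+ b ≡ r ℤ.+ (+ 1 ℤ.+ b)
    regroup = solve-∀

  H-nonnegative : ∀ n m r → H n m (+ r) ≡ Conv (+ n) (+ m) r
  H-nonnegative n m zero    = ≡.refl
  H-nonnegative n m (suc r) = ≡.refl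

  H-negative : ∀ n m r → H n m -[1+ r ] ≈ - Conv (+ m ℤ.- + suc r) (+ n ℤ.- + suc r) (suc r)
  H-negative n m r = -‿cong (∑-cong (suc r) (λ j → trans (*-comm _ _)
    (reflexive (≡.cong₂ (λ u v → A₀ u * A₀ v) (reindexˡ (+ m) (+ r) (+ j))
                                               (reindexʳ (+ n) (+ r) (+ j))))))
    where
    reindexˡ : ∀ m r j → m ℤ.- (+ 1 ℤ.+ r) ℤ.+ (+ 1 ℤ.+ j) ℤ.- + 1 ≡ m ℤ.- (+ 1 ℤ.+ r) ℤ.+ j
    reindexˡ = solve-∀
    reindexʳ : ∀ n r j → n ℤ.- (+ 1 ℤ.+ j) ≡ n ℤ.- (+ 1 ℤ.+ r) ℤ.+ (+ 1 ℤ.+ r) ℤ.- j ℤ.- + 1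
    reindexʳ = solve-∀

  S-pair-nonnegative : ∀ m n r → S n (+ m ℤ.+ + r) + S m (+ n ℤ.+ + r)
                                  ≈ A (m ℕ.+ n ℕ.+ r) 1 + Conv (+ n) (+ m) r
  S-pair-nonnegative m n r = begin
    S n (+ (m ℕ.+ r)) + S m (+ (n ℕ.+ r))
      ≡⟨ ≡.cong₂ (λ u v → S n (+ u) + S m (+ v)) (ℕ.+-comm m r) (ℕ.+-comm n r) ⟩
    S n (+ r ℤ.+ + m) + S m (+ (r ℕ.+ n))                      ≈⟨ +-congʳ (S-shift r n (+ m)) ⟩
    S (r ℕ.+ n) (+ m) + Conv (+ n) (+ m) r + S m (+ (r ℕ.+ n)) ≈⟨ xy∙z≈zx∙y _ _ _ ⟩
    S m (+ (r ℕ.+ n)) + S (r ℕ.+ n) (+ m) + Conv (+ n) (+ m) r ≈⟨ +-congʳ (S-diagonal m (r ℕ.+ n)) ⟩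
    A (m ℕ.+ (r ℕ.+ n)) 1 + Conv (+ n) (+ m) r                 ≡⟨ ≡.cong (λ t → A t 1 + Conv (+ n) (+ m) r) reassoc ⟩
    A (m ℕ.+ n ℕ.+ r) 1 + Conv (+ n) (+ m) r                   ∎
    where
    reassoc : m ℕ.+ (r ℕ.+ n) ≡ m ℕ.+ n ℕ.+ r
    reassoc = ≡.trans (≡.cong (m ℕ.+_) (ℕ.+-comm r n)) (≡.sym (ℕ.+-assoc m n r))

  S-pair-negative-≤ : ∀ m n R → let X = + m ℤ.- + R ; Y = + (R ℕ.+ n) ℤ.- + R in
                      S (R ℕ.+ n) X + S m Y ≈ Aℤ (+ m ℤ.+ + (R ℕ.+ n) ℤ.- + R) (+ 1) - Conv X Y R
  S-pair-negative-≤ m n R = x≈z//y _ _ _ (begin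
    S (R ℕ.+ n) X + S m Y + Conv X Y R
      ≡⟨ ≡.cong (λ t → S (R ℕ.+ n) X + S m t + Conv X t R) (cancel (+ R) (+ n)) ⟩
    S (R ℕ.+ n) X + S m (+ n) + Conv X (+ n) R  ≈⟨ xy∙z≈xz∙y _ _ _ ⟩
    S (R ℕ.+ n) X + Conv X (+ n) R + S m (+ n)  ≈⟨ +-congʳ (+-congˡ (Conv-comm X (+ n) R)) ⟩
    S (R ℕ.+ n) X + Conv (+ n) X R + S m (+ n)  ≈⟨ +-congʳ (sym (S-shift R n X)) ⟩
    S n (+ R ℤ.+ X) + S m (+ n)                 ≡⟨ ≡.cong (λ t → S n t + S m (+ n)) (restore (+ m) (+ R)) ⟩
    S n (+ m) + S m (+ n)                       ≈⟨ S-diagonal n m ⟩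
    A (n ℕ.+ m) 1                               ≡⟨ ≡.cong (λ t → Aℤ t (+ 1)) (total (+ m) (+ R) (+ n)) ⟩
    Aℤ (+ m ℤ.+ + (R ℕ.+ n) ℤ.- + R) (+ 1)      ∎)
    where
    X = + m ℤ.- + R
    Y = + (R ℕ.+ n) ℤ.- + R
    cancel : ∀ R n → R ℤ.+ n ℤ.- R ≡ n
    cancel = solve-∀
    restore : ∀ m R → R ℤ.+ (m ℤ.- R) ≡ m
    restore = solve-∀
    total : ∀ m R n → n ℤ.+ m ≡ m ℤ.+ (R ℤ.+ n) ℤ.- R
    total = solve-∀

  S-pair-negative-> : ∀ m n d → let N = suc (n ℕ.+ d) ; X = + m ℤ.- + N ; Y = + n ℤ.- + N in
                      S n X + S m Y ≈ Aℤ (+ m ℤ.+ + n ℤ.- + N) (+ 1) - Conv X Y N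
  S-pair-negative-> m n d = x≈z//y _ _ _ (begin
    S n X + S m Y + Conv X Y N
      ≡⟨ ≡.cong₂ (λ t u → S n X + S m t + Conv X t u) (negate (+ n) (+ d)) (≡.cong suc (ℕ.+-comm n d)) ⟩
    S n X + S m -[1+ d ] + Conv X -[1+ d ] (suc d ℕ.+ n)
      ≈⟨ +-cong (trans (+-congˡ (S-negative m d)) (+-identityʳ _)) (Conv-negative X (suc d) n) ⟩
    S n X + Conv X (+ 0) n
      ≈⟨ +-cong (reflexive (≡.cong (λ t → S t X) (≡.sym (ℕ.+-identityʳ n)))) (Conv-comm X (+ 0) n) ⟩
    S (n ℕ.+ 0) X + Conv (+ 0) X n              ≈⟨ sym (S-shift n 0 X) ⟩
    S 0 (+ n ℤ.+ X)                             ≈⟨ S-zeroˡ (+ n ℤ.+ X) ⟩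
    Aℤ (+ n ℤ.+ X) (+ 1)                        ≡⟨ ≡.cong (λ t → Aℤ t (+ 1)) (total (+ m) (+ n) (+ N)) ⟩
    Aℤ (+ m ℤ.+ + n ℤ.- + N) (+ 1)              ∎)
    where
    N = suc (n ℕ.+ d)
    X = + m ℤ.- + N
    Y = + n ℤ.- + N
    negate : ∀ n d → n ℤ.- (+ 1 ℤ.+ (n ℤ.+ d)) ≡ ℤ.- (+ 1 ℤ.+ d)
    negate = solve-∀
    total : ∀ m n N → n ℤ.+ (m ℤ.- N) ≡ m ℤ.+ n ℤ.- N
    total = solve-∀

  S-pair-negative : ∀ m n R → S n (+ m ℤ.- + R) + S m (+ n ℤ.- + R)
                              ≈ Aℤ (+ m ℤ.+ + n ℤ.- + R) (+ 1) - Conv (+ m ℤ.- + R) (+ n ℤ.- + R) R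
  S-pair-negative m n R with R ≤? n
  ... | yes R≤n with ℕ.m≤n⇒∃[o]m+o≡n R≤n
  ...   | n′ , ≡.refl = S-pair-negative-≤ m n′ R
  S-pair-negative m n R | no R≰n with ℕ.m≤n⇒∃[o]m+o≡n (ℕ.≰⇒> R≰n)
  ...   | d , ≡.refl = S-pair-negative-> m n d

  ∑-per≈S+S : ∀ m n r → n ≤ m →
              ∑ (suc m) (λ k → (z ^ k) * per (A n k) (Aℤ (+ n ℤ.+ r) (+ suc k))
                                             (A m k) (Aℤ (+ m ℤ.+ r) (+ suc k)))
              ≈ S n (+ m ℤ.+ r) + S m (+ n ℤ.+ r)
  ∑-per≈S+S m n r n≤m = begin
    _                                                                  ≈⟨ ∑-cong (suc m) (λ k → split _ _ _ _ _) ⟩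
    ∑ (suc m) (λ k → S-term n (+ m ℤ.+ r) k + S-term m (+ n ℤ.+ r) k)  ≈⟨ ∑-distrib-+ (suc m) _ _ ⟩
    ∑ (suc m) (S-term n (+ m ℤ.+ r)) + S m (+ n ℤ.+ r)                 ≈⟨ +-congʳ (S-extend (+ m ℤ.+ r) (s≤s n≤m)) ⟩
    S n (+ m ℤ.+ r) + S m (+ n ℤ.+ r)                                  ∎
    where
    open R-Solver
    split : ∀ w a b c d → w * (a * d + b * c) ≈ w * (a * d) + w * (c * b)
    split = solve 5 (λ w a b c d → w :* (a :* d :+ b :* c) := w :* (a :* d) :+ w :* (c :* b)) refl

theorem1p4 : ∀ {c ℓ : Level} (R : CommutativeRing c ℓ) (y z : CommutativeRing.Carrier R)
             (m n : ℕ) (r : ℤ) → n ≤ m →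
             let open CommutativeRing R
                 open Recursive R y z
             in ∑ (suc m) (λ k → (z ^ k) * per (A n k) (Aℤ (+ n ℤ.+ r) (+ suc k))
                                                (A m k) (Aℤ (+ m ℤ.+ r) (+ suc k)))
                ≈ Aℤ (+ m ℤ.+ + n ℤ.+ r) (+ 1) + H n m r
theorem1p4 R y z m n (+ r) n≤m = begin
  _                                                       ≈⟨ ∑-per≈S+S m n (+ r) n≤m ⟩
  S n (+ m ℤ.+ + r) + S m (+ n ℤ.+ + r)                   ≈⟨ S-pair-nonnegative m n r ⟩
  A (m ℕ.+ n ℕ.+ r) 1 + Conv (+ n) (+ m) r                ≈⟨ +-congˡ (reflexive (≡.sym (H-nonnegative n m r))) ⟩
  A (m ℕ.+ n ℕ.+ r) 1 + H n m (+ r)                       ∎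
  where
  open CommutativeRing R
  open Recursive R y z
  open Identities R y z
  open import Relation.Binary.Reasoning.Setoid setoid
theorem1p4 R y z m n -[1+ r ] n≤m = begin
  _                                                       ≈⟨ ∑-per≈S+S m n -[1+ r ] n≤m ⟩
  S n (+ m ℤ.- + suc r) + S m (+ n ℤ.- + suc r)           ≈⟨ S-pair-negative m n (suc r) ⟩
  Aℤ (+ m ℤ.+ + n ℤ.- + suc r) (+ 1) - Conv (+ m ℤ.- + suc r) (+ n ℤ.- + suc r) (suc r)
                                                          ≈⟨ +-congˡ (sym (H-negative n m r)) ⟩
  Aℤ (+ m ℤ.+ + n ℤ.- + suc r) (+ 1) + H n m -[1+ r ]     ∎
  where
  open CommutativeRing R
  open Recursive R y z
  open Identities R y z
  open import Relation.Binary.Reasoning.Setoid setoid
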